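{- Let $\pi\in\mathfrak{B}_n$ be a signed involution and $1\le i\le n$. If $\pi_i=i$ then $\operatorname{des}^B(\varphi_{(i+1,i)}(\pi))=\operatorname{des}^B(\pi)+1$, and if $\pi_i=-i$ then $\operatorname{des}^B(\overline{\varphi}_{(i+1,i)}(\pi))=\operatorname{des}^B(\pi)$.
   Context: $\mathfrak{B}_n$ is the set of signed permutations $\pi=\pi_1\cdots\pi_n$ ($\pi_i\in\{\pm1,\dots,\pm n\}$, $|\pi_1|,\dots,|\pi_n|$ a permutation of $[n]$), $\pi_0=0$; the inverse is given by $\pi^{ -1}_{|\pi_i|}=\operatorname{sgn}(\pi_i)\,i$ and $\pi$ is a signed involution if $\pi^{ -1}=\pi$. Natural order: $\operatorname{des}^B(\pi)=|\{i\in\{0,\dots,n-1\}:\pi_i>\pi_{i+1}\}|$. For $i,j\in[n+1]$, $\varphi_{(i,j)}(\pi)$ is the $\sigma\in\mathfrak{B}_{n+1}$ with $\sigma_i=j$, $\sigma_k=s(\pi_k)$ for $k<i$, $\sigma_k=s(\pi_{k-1})$ for $k>i$, where $s(x)=x$ if $|x|<j$, $s(x)=x+1$ if $x\ge j$, $s(x)=x-1$ if $x\le-j$; $\overline{\varphi}_{(i,j)}(\pi)$ is the same with $\sigma_i=-j$. -}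

module Defs where

open import Data.Nat as ℕ using (ℕ; zero; suc; _∸_)
open import Data.Integer as ℤ using (ℤ; +_; -_; sign; _◃_; ∣_∣)
open import Data.Integer.Properties using (_<?_; _≤?_)
open import Data.List using (List; []; _∷_; map; length; take; drop; _++_; upTo)
open import Data.List.Relation.Binary.Permutation.Propositional using (_↭_)
open import Data.Product using (_×_)
open import Relation.Nullary.Decidable using (does)
open import Data.Bool using (if_then_else_)
open import Relation.Binary.PropositionalEquality using (_≡_)

-- A signed permutation π = π₁ ⋯ πₙ is represented by the list [π₁, …, πₙ] of integers.
-- π ∈ 𝔅ₙ : length n and |π₁|,…,|πₙ| is a permutation of [n] = 1,…,n.
IsSignedPerm : ℕ → List ℤ → Set
IsSignedPerm n π = (length π ≡ n) × (map ∣_∣ π ↭ map suc (upTo n))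

-- 1-based entry πᵢ, with the convention π₀ = 0 (out-of-range indices also give 0).
entry : List ℤ → ℕ → ℤ
entry π        zero          = + 0
entry []       (suc _)       = + 0
entry (x ∷ xs) (suc zero)    = x
entry (x ∷ xs) (suc (suc k)) = entry xs (suc k)

IsInverseOf : ℕ → List ℤ → List ℤ → Set
IsInverseOf n σ π = ∀ i → 1 ℕ.≤ i → i ℕ.≤ n → entry σ ∣ entry π i ∣ ≡ sign (entry π i) ◃ i

IsSignedInvolution : ℕ → List ℤ → Set
IsSignedInvolution n π = IsInverseOf n π π

-- number of i ∈ {0,…,n-1} with πᵢ > πᵢ₊₁ (π₀ = 0), natural order on ℤ
descentsFrom : ℤ → List ℤ → ℕ
descentsFrom prev []       = 0
descentsFrom prev (x ∷ xs) = (if does (x <? prev) then 1 else 0) ℕ.+ descentsFrom x xs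

desB : List ℤ → ℕ
desB π = descentsFrom (+ 0) π

shift : ℕ → ℤ → ℤ
shift j x =
  if does (+ j ≤? x) then x ℤ.+ + 1
  else (if does (x ≤? - (+ j)) then x ℤ.- + 1 else x)

insertAt : ℕ → ℕ → ℤ → List ℤ → List ℤ
insertAt i j v π = map (shift j) (take (i ∸ 1) π) ++ (v ∷ map (shift j) (drop (i ∸ 1) π))

φ : ℕ → ℕ → List ℤ → List ℤ
φ i j π = insertAt i j (+ j) π

φbar : ℕ → ℕ → List ℤ → List ℤ
φbar i j π = insertAt i j (- (+ j)) π

-- The shift s = shift i is strictly monotone and fixes 0, so it preserves every descent of π;
-- the only change to the descent set happens around the inserted entry ±i at position i + 1.
-- If πᵢ = i, then s(πᵢ) = i + 1 > i is a new descent, and πᵢ₊₁ < i ⇔ s(πᵢ₊₁) < i, so the step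
-- into πᵢ₊₁ is unchanged.  If πᵢ = -i, then s(πᵢ) = -i - 1 < -i is no descent, and
-- πᵢ₊₁ < -i ⇔ s(πᵢ₊₁) < -i as long as πᵢ₊₁ ≠ -i, which holds for an involution because
-- πᵢ₊₁ = -i would force πᵢ = -(i + 1).
module Submission where

open import Defs
open import Data.Nat using (ℕ; suc; _≤_)
open import Data.Integer using (ℤ; +_; -_)
open import Data.List using (List)
open import Data.Product using (_×_)
open import Relation.Binary.PropositionalEquality using (_≡_)

open import Data.Nat as ℕ using (zero; z≤n; s≤s)
import Data.Nat.Properties as ℕP
open import Algebra.Properties.CommutativeSemigroup ℕP.+-commutativeSemigroup using (x∙yz≈y∙xz)
open import Data.Integer as ℤ using (1ℤ; ∣_∣; sign; _◃_)
open import Data.Integer.Properties as ℤP using (_<?_; _≤?_)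
open import Data.List using ([]; _∷_; map; take; drop; _++_; length; head)
open import Data.List.Properties using (take++drop≡id)
open import Data.Maybe.Relation.Unary.All using (All; just; nothing)
open import Data.Product using (_,_)
open import Data.Bool using (if_then_else_)
open import Relation.Binary using (_Preserves_⟶_; tri<; tri≈; tri>)
open import Relation.Binary.PropositionalEquality
  using (refl; sym; trans; cong; cong₂; subst; _≢_; module ≡-Reasoning)
open import Relation.Nullary using (does; yes; no; contradiction)
open import Relation.Nullary.Decidable using (dec-true; dec-false)

open ≡-Reasoning

descent : ℤ → ℤ → ℕ
descent prev x = if does (x <? prev) then 1 else 0

lastOr : {A : Set} → A → List A → A
lastOr p []       = p
lastOr p (x ∷ xs) = lastOr x xs

lastOr-map : ∀ {A B : Set} (f : A → B) p xs → lastOr (f p) (map f xs) ≡ f (lastOr p xs)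
lastOr-map f p []       = refl
lastOr-map f p (x ∷ xs) = lastOr-map f x xs

lastOr-take : ∀ (p : ℤ) xs k → suc k ≤ length xs → lastOr p (take (suc k) xs) ≡ entry xs (suc k)
lastOr-take p (x ∷ xs) zero    _           = refl
lastOr-take p (x ∷ xs) (suc k) (s≤s k<len) = lastOr-take x xs k k<len

All-head-drop : ∀ {P : ℤ → Set} xs k → (suc k ≤ length xs → P (entry xs (suc k))) →
  All P (head (drop k xs))
All-head-drop []       zero    _  = nothing
All-head-drop []       (suc k) _  = nothing
All-head-drop (x ∷ xs) zero    Px = just (Px (s≤s z≤n))
All-head-drop (x ∷ xs) (suc k) Px = All-head-drop xs k (λ k<len → Px (s≤s k<len))

i<i+1 : ∀ i → i ℤ.< i ℤ.+ 1ℤ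
i<i+1 i = subst (ℤ._< i ℤ.+ 1ℤ) (ℤP.+-identityʳ i) (ℤP.+-monoʳ-< i (ℤ.+<+ (s≤s z≤n)))

i-1<i : ∀ i → i ℤ.- 1ℤ ℤ.< i
i-1<i i = subst (i ℤ.- 1ℤ ℤ.<_) (ℤP.+-identityʳ i) (ℤP.+-monoʳ-< i ℤ.-<+)

-j≤+j : ∀ j → - (+ j) ℤ.≤ + j
-j≤+j zero    = ℤP.≤-refl
-j≤+j (suc j) = ℤ.-≤+

strictMono⇒does-<-preserved : ∀ {f : ℤ → ℤ} → f Preserves ℤ._<_ ⟶ ℤ._<_ →
  ∀ x y → does (f x <? f y) ≡ does (x <? y)
strictMono⇒does-<-preserved {f} mono x y with ℤP.<-cmp x y
... | tri< x<y _ _    = trans (dec-true (f x <? f y) (mono x<y)) (sym (dec-true (x <? y) x<y))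
... | tri≈ x≮y refl _ = trans (dec-false (f x <? f y) (ℤP.<-irrefl refl)) (sym (dec-false (x <? y) x≮y))
... | tri> x≮y _ y<x  = trans (dec-false (f x <? f y) (ℤP.<-asym (mono y<x))) (sym (dec-false (x <? y) x≮y))

data ShiftView (j : ℕ) (x : ℤ) : ℤ → Set where
  above   : + j ℤ.≤ x → ShiftView j x (x ℤ.+ 1ℤ)
  below   : x ℤ.< + j → x ℤ.≤ - (+ j) → ShiftView j x (x ℤ.- 1ℤ)
  between : x ℤ.< + j → - (+ j) ℤ.< x → ShiftView j x x

shiftView : ∀ j x → ShiftView j x (shift j x)
shiftView j x with + j ≤? x | x ≤? - (+ j)
... | yes j≤x | _        = above j≤x
... | no j≰x  | yes x≤-j = below (ℤP.≰⇒> j≰x) x≤-j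
... | no j≰x  | no x≰-j  = between (ℤP.≰⇒> j≰x) (ℤP.≰⇒> x≰-j)

shift-strictMono : ∀ j → shift j Preserves ℤ._<_ ⟶ ℤ._<_
shift-strictMono j {x} {y} x<y with shift j x | shiftView j x | shift j y | shiftView j y
... | _ | above _         | _ | above _        = ℤP.+-monoˡ-< 1ℤ x<y
... | _ | above j≤x       | _ | below y<j _    = contradiction (ℤP.≤-<-trans j≤x x<y) (ℤP.<-asym y<j)
... | _ | above j≤x       | _ | between y<j _  = contradiction (ℤP.≤-<-trans j≤x x<y) (ℤP.<-asym y<j)
... | _ | below _ _       | _ | above _        = ℤP.<-trans (i-1<i x) (ℤP.<-trans x<y (i<i+1 y))
... | _ | below _ _       | _ | below _ _      = ℤP.+-monoˡ-< (- 1ℤ) x<y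
... | _ | below _ _       | _ | between _ _    = ℤP.<-trans (i-1<i x) x<y
... | _ | between _ _     | _ | above _        = ℤP.<-trans x<y (i<i+1 y)
... | _ | between _ -j<x  | _ | below _ y≤-j   = contradiction (ℤP.<-≤-trans x<y y≤-j) (ℤP.<-asym -j<x)
... | _ | between _ _     | _ | between _ _    = x<y

shift-<-+ : ∀ j y → does (shift j y <? + j) ≡ does (y <? + j)
shift-<-+ j y with shift j y | shiftView j y
... | _ | above j≤y = trans (dec-false (_ <? + j) (ℤP.<-asym (ℤP.≤-<-trans j≤y (i<i+1 y))))
                            (sym (dec-false (y <? + j) (ℤP.≤⇒≯ j≤y)))
... | _ | below y<j _ = trans (dec-true (_ <? + j) (ℤP.<-trans (i-1<i y) y<j)) (sym (dec-true (y <? + j) y<j))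
... | _ | between _ _ = refl

shift-<-- : ∀ j y → y ≢ - (+ j) → does (shift j y <? - (+ j)) ≡ does (y <? - (+ j))
shift-<-- j y y≢-j with shift j y | shiftView j y
... | _ | above j≤y = trans (dec-false (_ <? - (+ j)) (ℤP.≤⇒≯ (ℤP.≤-trans -j≤y (ℤP.<⇒≤ (i<i+1 y)))))
                            (sym (dec-false (y <? - (+ j)) (ℤP.≤⇒≯ -j≤y)))
  where -j≤y = ℤP.≤-trans (-j≤+j j) j≤y
... | _ | below _ y≤-j = trans (dec-true (_ <? - (+ j)) (ℤP.<-trans (i-1<i y) y<-j)) (sym (dec-true (y <? - (+ j)) y<-j))
  where y<-j = ℤP.≤∧≢⇒< y≤-j y≢-j
... | _ | between _ _ = refl

descent-shift-+ : ∀ j → descent (shift j (+ j)) (+ j) ≡ 1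
descent-shift-+ j with shift j (+ j) | shiftView j (+ j)
... | _ | above _     = cong (λ b → if b then 1 else 0) (dec-true (+ j <? + j ℤ.+ 1ℤ) (i<i+1 (+ j)))
... | _ | below j<j _ = contradiction j<j (ℤP.<-irrefl refl)
... | _ | between j<j _ = contradiction j<j (ℤP.<-irrefl refl)

descent-shift-- : ∀ m → descent (shift (suc m) (- (+ suc m))) (- (+ suc m)) ≡ 0
descent-shift-- m with shift (suc m) (- (+ suc m)) | shiftView (suc m) (- (+ suc m))
... | _ | above ()
... | _ | below _ _ = cong (λ b → if b then 1 else 0)
                        (dec-false (- (+ suc m) <? - (+ suc m) ℤ.- 1ℤ) (ℤP.<-asym (i-1<i (- (+ suc m)))))
... | _ | between _ -j<-j = contradiction -j<-j (ℤP.<-irrefl refl)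

descentsFrom-++ : ∀ p xs ys → descentsFrom p (xs ++ ys) ≡ descentsFrom p xs ℕ.+ descentsFrom (lastOr p xs) ys
descentsFrom-++ p []       ys = refl
descentsFrom-++ p (x ∷ xs) ys = begin
  descent p x ℕ.+ descentsFrom x (xs ++ ys)
    ≡⟨ cong (descent p x ℕ.+_) (descentsFrom-++ x xs ys) ⟩
  descent p x ℕ.+ (descentsFrom x xs ℕ.+ descentsFrom (lastOr x xs) ys)
    ≡⟨ sym (ℕP.+-assoc (descent p x) _ _) ⟩
  descent p x ℕ.+ descentsFrom x xs ℕ.+ descentsFrom (lastOr x xs) ys ∎

module _ {f : ℤ → ℤ} (f-strictMono : f Preserves ℤ._<_ ⟶ ℤ._<_) where

  descentsFrom-map : ∀ p xs → descentsFrom (f p) (map f xs) ≡ descentsFrom p xs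
  descentsFrom-map p []       = refl
  descentsFrom-map p (x ∷ xs) =
    cong₂ (λ b d → (if b then 1 else 0) ℕ.+ d)
      (strictMono⇒does-<-preserved f-strictMono x p) (descentsFrom-map x xs)

  descentsFrom-map-restart : ∀ c v ys → All (λ y → does (f y <? v) ≡ does (y <? c)) (head ys) →
    descentsFrom v (map f ys) ≡ descentsFrom c ys
  descentsFrom-map-restart c v []       nothing   = refl
  descentsFrom-map-restart c v (y ∷ ys) (just eq) =
    cong₂ (λ b d → (if b then 1 else 0) ℕ.+ d) eq (descentsFrom-map y ys)

  descentsFrom-insert : ∀ p k v xs → let c = lastOr p (take k xs) in
    All (λ y → does (f y <? v) ≡ does (y <? c)) (head (drop k xs)) →
    descentsFrom (f p) (map f (take k xs) ++ v ∷ map f (drop k xs)) ≡ descent (f c) v ℕ.+ descentsFrom p xs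
  descentsFrom-insert p k v xs next = begin
    descentsFrom (f p) (map f pre ++ v ∷ map f post)
      ≡⟨ descentsFrom-++ (f p) (map f pre) (v ∷ map f post) ⟩
    descentsFrom (f p) (map f pre) ℕ.+ descentsFrom (lastOr (f p) (map f pre)) (v ∷ map f post)
      ≡⟨ cong₂ ℕ._+_ (descentsFrom-map p pre) (cong (λ q → descentsFrom q (v ∷ map f post)) (lastOr-map f p pre)) ⟩
    descentsFrom p pre ℕ.+ (descent (f c) v ℕ.+ descentsFrom v (map f post))
      ≡⟨ cong (λ d → descentsFrom p pre ℕ.+ (descent (f c) v ℕ.+ d)) (descentsFrom-map-restart c v post next) ⟩
    descentsFrom p pre ℕ.+ (descent (f c) v ℕ.+ descentsFrom c post)
      ≡⟨ x∙yz≈y∙xz (descentsFrom p pre) (descent (f c) v) (descentsFrom c post) ⟩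
    descent (f c) v ℕ.+ (descentsFrom p pre ℕ.+ descentsFrom c post)
      ≡⟨ cong (descent (f c) v ℕ.+_) (sym (descentsFrom-++ p pre post)) ⟩
    descent (f c) v ℕ.+ descentsFrom p (pre ++ post)
      ≡⟨ cong (λ ys → descent (f c) v ℕ.+ descentsFrom p ys) (take++drop≡id k xs) ⟩
    descent (f c) v ℕ.+ descentsFrom p xs ∎
    where
    pre  = take k xs
    post = drop k xs
    c    = lastOr p pre

-- shift (suc m) (+ 0) reduces to + 0, which is how desB fits descentsFrom-insert.
desB-insertAt : ∀ m v π c → suc m ≤ length π → entry π (suc m) ≡ c →
  All (λ y → does (shift (suc m) y <? v) ≡ does (y <? c)) (head (drop (suc m) π)) →
  desB (insertAt (suc (suc m)) (suc m) v π) ≡ descent (shift (suc m) c) v ℕ.+ desB π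
desB-insertAt m v π c i≤len πᵢ≡c next
  with refl ← trans (lastOr-take (+ 0) π m i≤len) πᵢ≡c
  = descentsFrom-insert (shift-strictMono (suc m)) (+ 0) (suc m) v π next

signedInvolution-neg : ∀ {n π} → IsSignedInvolution n π → ∀ {i j} → 1 ≤ j → j ≤ n →
  entry π j ≡ - (+ suc i) → entry π (suc i) ≡ - (+ j)
signedInvolution-neg {π = π} involution {j = suc j} 1≤j j≤n πⱼ≡-i =
  subst (λ y → entry π ∣ y ∣ ≡ sign y ◃ suc j) πⱼ≡-i (involution (suc j) 1≤j j≤n)

proposition5p2 : (n : ℕ) (π : List ℤ) → IsSignedPerm n π → IsSignedInvolution n π →
    (i : ℕ) → 1 ≤ i → i ≤ n →
      (entry π i ≡ + i → desB (φ (suc i) i π) ≡ suc (desB π))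
      × (entry π i ≡ - (+ i) → desB (φbar (suc i) i π) ≡ desB π)
proposition5p2 n π (length≡n , _) involution i@(suc m) _ i≤n = fixed , negated
  where
  i≤len : i ≤ length π
  i≤len = subst (i ≤_) (sym length≡n) i≤n

  fixed : entry π i ≡ + i → desB (φ (suc i) i π) ≡ suc (desB π)
  fixed πᵢ≡i = begin
    desB (φ (suc i) i π)
      ≡⟨ desB-insertAt m (+ i) π (+ i) i≤len πᵢ≡i (All-head-drop π i (λ _ → shift-<-+ i (entry π (suc i)))) ⟩
    descent (shift i (+ i)) (+ i) ℕ.+ desB π
      ≡⟨ cong (ℕ._+ desB π) (descent-shift-+ i) ⟩
    suc (desB π) ∎

  negated : entry π i ≡ - (+ i) → desB (φbar (suc i) i π) ≡ desB π
  negated πᵢ≡-i = begin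
    desB (φbar (suc i) i π)
      ≡⟨ desB-insertAt m (- (+ i)) π (- (+ i)) i≤len πᵢ≡-i (All-head-drop π i next) ⟩
    descent (shift i (- (+ i))) (- (+ i)) ℕ.+ desB π
      ≡⟨ cong (ℕ._+ desB π) (descent-shift-- m) ⟩
    desB π ∎
    where
    next : suc i ≤ length π → does (shift i (entry π (suc i)) <? - (+ i)) ≡ does (entry π (suc i) <? - (+ i))
    next i<len = shift-<-- i (entry π (suc i)) λ πᵢ₊₁≡-i →
      contradiction (trans (sym πᵢ≡-i)
        (signedInvolution-neg involution (s≤s z≤n) (subst (suc i ≤_) length≡n i<len) πᵢ₊₁≡-i)) λ ()
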